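{- Let $n\ge 1$, let $\mathscr{M}_n\subset\mathbb{Z}_{\ge0}^{n^2-n}$ be the monoid of ordered score sheets of a round-robin tournament between $n$ teams, and let $C_n=\mathbb{R}_{+}\mathscr{M}_n\subset\mathbb{R}^{n^2-n}$ be the cone it generates. Then the Hilbert basis of $\mathscr{M}_n$ equals the set of extreme integral generators of $C_n$.
   Context: A score sheet of a round-robin tournament between $n$ teams is a family $S=(g_{ij})_{1\le i\neq j\le n}$ of nonnegative integers, identified with an element of $\mathbb{Z}_{\ge 0}^{n^2-n}$, with entrywise addition. Let $g_i=\sum_{j\neq i}g_{ij}$. The ordered score sheets are those with $g_1\ge g_2\ge\cdots\ge g_n$; they form a monoid $\mathscr{M}_n$. The Hilbert basis of a positive affine monoid is its set of irreducible elements (nonzero elements not expressible as a sum of two nonzero elements). The extreme integral generators of a rational pointed cone are the vectors with coprime integer components spanning its one-dimensional faces (extreme rays).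
   Formalization: The cone $C_n$ is taken over ℚ rather than ℝ: its points are nonnegative rational combinations of elements of $\mathscr{M}_n$, and extreme rays are tested only against decompositions into such points. -}

module Defs where

open import Data.Nat as ℕ using (ℕ; zero; suc)
open import Data.Nat.Divisibility using (_∣_)
open import Data.Integer as ℤ using (ℤ; +_)
open import Data.Rational as ℚ using (ℚ; 0ℚ; _/_)
open import Data.Fin using (Fin; _≤_; _≟_)
open import Data.List using (List; allFin; foldr; map)
open import Data.Nat.ListAction using (sum)
open import Data.Product using (Σ; _×_; ∃; ∃-syntax; _,_)
open import Relation.Nullary using (¬_; yes; no)
open import Relation.Binary.PropositionalEquality using (_≡_; _≢_)

-- A score sheet of a round robin tournament between n teams with entries in A:
-- a family (g i j) indexed by ordered pairs i ≠ j of teams (the lattice ℤ^(n²-n)).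
Sheet : Set → ℕ → Set
Sheet A n = (i j : Fin n) → i ≢ j → A

_≐_ : ∀ {A n} → Sheet A n → Sheet A n → Set
_≐_ {n = n} x y = (i j : Fin n) (p : i ≢ j) → x i j p ≡ y i j p

_⊕_ : ∀ {n} → Sheet ℕ n → Sheet ℕ n → Sheet ℕ n
(x ⊕ y) i j p = x i j p ℕ.+ y i j p

IsZero : ∀ {n} → Sheet ℕ n → Set
IsZero {n} x = (i j : Fin n) (p : i ≢ j) → x i j p ≡ 0

score : ∀ {n} → Sheet ℕ n → Fin n → ℕ
score {n} g i = sum (map f (allFin n))
  where
  f : Fin n → ℕ
  f j with i ≟ j
  ... | yes _ = 0
  ... | no i≢j = g i j i≢j

Ordered : ∀ {n} → Sheet ℕ n → Set
Ordered {n} g = (i j : Fin n) → i ≤ j → score g j ℕ.≤ score g i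

InM : ∀ {n} → Sheet ℕ n → Set
InM = Ordered

InHilbertBasis : ∀ {n} → Sheet ℕ n → Set
InHilbertBasis {n} x =
  InM x × ¬ IsZero x ×
  ¬ (Σ (Sheet ℕ n) λ y → Σ (Sheet ℕ n) λ z →
        InM y × InM z × ¬ IsZero y × ¬ IsZero z × x ≐ (y ⊕ z))

toℤ : ∀ {n} → Sheet ℕ n → Sheet ℤ n
toℤ x i j p = + (x i j p)

ℤtoℚ : ℤ → ℚ
ℤtoℚ k = k / 1

-- rational points of the cone C_n = ℝ₊ 𝓜_n : finite nonnegative
-- combinations Σ λ_k m_k with m_k ∈ 𝓜_n and λ_k ≥ 0
InCone : ∀ {n} → Sheet ℚ n → Set
InCone {n} x =
  Σ (List (ℚ × Σ (Sheet ℕ n) InM)) λ gens →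
    All≥0 gens ×
    ((i j : Fin n) (p : i ≢ j) →
       x i j p ≡ foldr (λ { (λk , (m , _)) acc → λk ℚ.* ℤtoℚ (+ (m i j p)) ℚ.+ acc }) 0ℚ gens)
  where
  All≥0 : List (ℚ × Σ (Sheet ℕ n) InM) → Set
  All≥0 gens = foldr (λ { (λk , _) acc → (0ℚ ℚ.≤ λk) × acc }) (Data.Unit.⊤) gens
    where import Data.Unit

_⊕ℚ_ : ∀ {n} → Sheet ℚ n → Sheet ℚ n → Sheet ℚ n
(x ⊕ℚ y) i j p = x i j p ℚ.+ y i j p

_·ℚ_ : ∀ {n} → ℚ → Sheet ℚ n → Sheet ℚ n
(c ·ℚ x) i j p = c ℚ.* x i j p

toℚ : ∀ {n} → Sheet ℤ n → Sheet ℚ n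
toℚ v i j p = ℤtoℚ (v i j p)

SpansExtremeRay : ∀ {n} → Sheet ℚ n → Set
SpansExtremeRay {n} v =
  InCone v ×
  ¬ ((i j : Fin n) (p : i ≢ j) → v i j p ≡ 0ℚ) ×
  ((y z : Sheet ℚ n) → InCone y → InCone z → v ≐ (y ⊕ℚ z) →
     Σ ℚ λ c → (0ℚ ℚ.≤ c) × y ≐ (c ·ℚ v))

Coprime : ∀ {n} → Sheet ℤ n → Set
Coprime {n} v = (d : ℕ) → ((i j : Fin n) (p : i ≢ j) → d ∣ ℤ.∣ v i j p ∣) → d ≡ 1

ExtremeIntegralGenerator : ∀ {n} → Sheet ℤ n → Set
ExtremeIntegralGenerator v = Coprime v × SpansExtremeRay (toℚ v)

{-# OPTIONS --safe #-}
module Submission where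

-- The Hilbert basis of 𝓜_n consists exactly of the ordered sheets with top
-- score g₁ = 1. Capping every row of an ordered sheet x at total 1 splits
-- x = u + r into ordered sheets with scores min(1, g_i) and g_i ∸ 1, so an
-- irreducible x has top score 1; conversely scores add, and an ordered sheet
-- with top score 0 vanishes, so a sheet with top score 1 is irreducible.
--
-- Such a sheet x spans an extreme ray: if x = y + z in the cone, an entry
-- x_ij = 1 is squeezed by y_ij ≤ score_y(i) ≤ score_y(1) and the same for z,
-- while y_ij + z_ij = 1 = score_y(1) + score_z(1); hence y = score_y(1)·x.
-- Conversely, for an extreme integral generator v the split v = u + r forces
-- u = c·v; comparing top scores gives c·s = 1 for the top score s of v, so
-- v = s·u and coprimality gives s = 1.
--
-- Every property of the cone used here is an instance of one principle: a
-- linear inequality L ≤ L′ that holds on 𝓜_n holds on its cone.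

open import Defs
open import Algebra.Bundles using (CommutativeRing)
import Algebra.Properties.Semiring.Sum as SemiringSum
open import Data.Nat as ℕ using (ℕ; zero; suc; z≤n; _≤_; _<_; _+_; _*_; _⊓_; _∸_)
import Data.Nat.Properties as ℕP
open import Data.Nat.Coprimality using (1-coprimeTo)
import Data.Nat.Coprimality as Coprimality
open import Data.Nat.Divisibility using (_∣_; _∣0; ∣m∣n⇒∣m+n; ∣1⇒≡1; m∣m*n)
open import Data.Nat.ListAction using (sum)
open import Data.Integer as ℤ using (ℤ; -[1+_])
import Data.Integer.Properties as ℤP
open import Data.Rational as ℚ using (ℚ; 0ℚ; 1ℚ; mkℚ; _/_)
import Data.Rational.Properties as ℚP
open import Data.Fin as Fin using (Fin; _≟_) renaming (zero to fzero; suc to fsuc)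
open import Data.List using (List; []; _∷_; map; tabulate; allFin; foldr)
open import Data.List.Relation.Unary.All using (All; []; _∷_)
open import Data.Product using (Σ; _×_; _,_; proj₁; proj₂)
open import Data.Sum using (inj₁; inj₂)
open import Data.Unit using (⊤; tt)
open import Data.Vec.Functional using (Vector; tail)
open import Function using (_∘_)
open import Relation.Nullary using (¬_; yes; no; contradiction)
open import Relation.Nullary.Decidable using (decidable-stable)
open import Relation.Binary.PropositionalEquality

module ℕΣ = SemiringSum ℕP.+-*-semiring
module ℚΣ = SemiringSum (CommutativeRing.semiring ℚP.+-*-commutativeRing)

private variable
  n : ℕ
  A B C : Set

ℕtoℚ : ℕ → ℚ
ℕtoℚ k = ℤtoℚ (ℤ.+ k)

ℕtoℚ≡mkℚ : ∀ k → ℕtoℚ k ≡ mkℚ (ℤ.+ k) 0 (Coprimality.sym (1-coprimeTo k))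
ℕtoℚ≡mkℚ k = ℚP.normalize-coprime (Coprimality.sym (1-coprimeTo k))

ℕtoℚ-+ : ∀ a b → ℕtoℚ (a + b) ≡ ℕtoℚ a ℚ.+ ℕtoℚ b
ℕtoℚ-+ a b = begin
  ℕtoℚ (a + b)                                        ≡⟨ cong₂ (λ s t → (s ℤ.+ t) / 1) (ℤP.*-identityʳ (ℤ.+ a)) (ℤP.*-identityʳ (ℤ.+ b)) ⟨
  (ℤ.+ a ℤ.* ℤ.+ 1 ℤ.+ ℤ.+ b ℤ.* ℤ.+ 1) / 1           ≡⟨ cong₂ ℚ._+_ (ℕtoℚ≡mkℚ a) (ℕtoℚ≡mkℚ b) ⟨
  ℕtoℚ a ℚ.+ ℕtoℚ b                                   ∎
  where open ≡-Reasoning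

ℕtoℚ-* : ∀ a b → ℕtoℚ (a * b) ≡ ℕtoℚ a ℚ.* ℕtoℚ b
ℕtoℚ-* a b = begin
  ℕtoℚ (a * b)                ≡⟨ cong (_/ 1) (ℤP.pos-* a b) ⟩
  (ℤ.+ a ℤ.* ℤ.+ b) / 1       ≡⟨ cong₂ ℚ._*_ (ℕtoℚ≡mkℚ a) (ℕtoℚ≡mkℚ b) ⟨
  ℕtoℚ a ℚ.* ℕtoℚ b           ∎
  where open ≡-Reasoning

ℕtoℚ-injective : ∀ {a b} → ℕtoℚ a ≡ ℕtoℚ b → a ≡ b
ℕtoℚ-injective {a} {b} eq with trans (sym (ℕtoℚ≡mkℚ a)) (trans eq (ℕtoℚ≡mkℚ b))
... | refl = refl

ℕtoℚ-mono-≤ : ∀ {a b} → a ≤ b → ℕtoℚ a ℚ.≤ ℕtoℚ b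
ℕtoℚ-mono-≤ {a} {b} a≤b rewrite ℕtoℚ≡mkℚ a | ℕtoℚ≡mkℚ b =
  ℚ.*≤* (ℤP.*-monoʳ-≤-nonNeg (ℤ.+ 1) (ℤ.+≤+ a≤b))

ℕtoℚ-cancel-≤ : ∀ {a b} → ℕtoℚ a ℚ.≤ ℕtoℚ b → a ≤ b
ℕtoℚ-cancel-≤ {a} {b} le rewrite ℕtoℚ≡mkℚ a | ℕtoℚ≡mkℚ b =
  ℤP.drop‿+≤+ (ℤP.*-cancelʳ-≤-pos (ℤ.+ a) (ℤ.+ b) (ℤ.+ 1) (ℚP.drop-*≤* le))

0≤ℕtoℚ : ∀ k → 0ℚ ℚ.≤ ℕtoℚ k
0≤ℕtoℚ k = ℕtoℚ-mono-≤ {0} {k} z≤n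

0≤ℤtoℚ⇒≡+∣∣ : ∀ k → 0ℚ ℚ.≤ ℤtoℚ k → k ≡ ℤ.+ ℤ.∣ k ∣
0≤ℤtoℚ⇒≡+∣∣ (ℤ.+ k)   _   = refl
0≤ℤtoℚ⇒≡+∣∣ -[1+ k ] 0≤k with ℚP.drop-*≤* (subst (0ℚ ℚ.≤_) (cong ℚ.-_ (ℕtoℚ≡mkℚ (suc k))) 0≤k)
... | ()

+-≡-squeezeˡ : ∀ {a b c d} → a ℚ.≤ b → c ℚ.≤ d → a ℚ.+ c ≡ b ℚ.+ d → a ≡ b
+-≡-squeezeˡ a≤b c≤d a+c≡b+d =
  ℚP.≤-antisym a≤b (ℚP.≮⇒≥ λ a<b → ℚP.<⇒≢ (ℚP.+-mono-<-≤ a<b c≤d) a+c≡b+d)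

c*s≡1∧u≡c*x⇒s*u≡x : ∀ {c} s u x → c ℚ.* ℕtoℚ s ≡ 1ℚ → ℕtoℚ u ≡ c ℚ.* ℕtoℚ x → s * u ≡ x
c*s≡1∧u≡c*x⇒s*u≡x {c} s u x c*s≡1 u≡c*x = ℕtoℚ-injective (begin
  ℕtoℚ (s * u)                    ≡⟨ ℕtoℚ-* s u ⟩
  ℕtoℚ s ℚ.* ℕtoℚ u               ≡⟨ cong (ℕtoℚ s ℚ.*_) u≡c*x ⟩
  ℕtoℚ s ℚ.* (c ℚ.* ℕtoℚ x)       ≡⟨ ℚP.*-assoc (ℕtoℚ s) c (ℕtoℚ x) ⟨
  (ℕtoℚ s ℚ.* c) ℚ.* ℕtoℚ x       ≡⟨ cong (ℚ._* ℕtoℚ x) (trans (ℚP.*-comm (ℕtoℚ s) c) c*s≡1) ⟩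
  1ℚ ℚ.* ℕtoℚ x                   ≡⟨ ℚP.*-identityˡ (ℕtoℚ x) ⟩
  ℕtoℚ x                          ∎)
  where open ≡-Reasoning

sum-map-tabulate : ∀ {m} (h : Fin n → ℕ) (g : Fin m → Fin n) → sum (map h (tabulate g)) ≡ ℕΣ.sum (h ∘ g)
sum-map-tabulate {m = zero}  h g = refl
sum-map-tabulate {m = suc m} h g = cong (h (g fzero) +_) (sum-map-tabulate h (g ∘ fsuc))

∣-∑ : ∀ {d} (f : Vector ℕ n) → (∀ j → d ∣ f j) → d ∣ ℕΣ.sum f
∣-∑ {zero}  f d∣f = _ ∣0
∣-∑ {suc n} f d∣f = ∣m∣n⇒∣m+n (d∣f fzero) (∣-∑ (tail f) (d∣f ∘ fsuc))

≤-∑ : (f : Vector ℕ n) (j : Fin n) → f j ≤ ℕΣ.sum f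
≤-∑ {suc n} f j = subst (f j ≤_) (sym (ℕΣ.sum-remove f)) (ℕP.m≤m+n (f j) _)

∑≡0⇒≡0 : (f : Vector ℕ n) (j : Fin n) → ℕΣ.sum f ≡ 0 → f j ≡ 0
∑≡0⇒≡0 {suc n} f j ∑f≡0 = ℕP.m+n≡0⇒m≡0 (f j) (trans (sym (ℕΣ.sum-remove f)) ∑f≡0)

ℕtoℚ-∑ : (f : Vector ℕ n) → ℕtoℚ (ℕΣ.sum f) ≡ ℚΣ.sum (ℕtoℚ ∘ f)
ℕtoℚ-∑ {zero}  f = refl
ℕtoℚ-∑ {suc n} f = trans (ℕtoℚ-+ (f fzero) _) (cong (ℕtoℚ (f fzero) ℚ.+_) (ℕtoℚ-∑ (tail f)))

cap : ℕ → Vector ℕ n → Vector ℕ n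
cap k f fzero    = k ⊓ f fzero
cap k f (fsuc j) = cap (k ∸ f fzero) (tail f) j

cap-≤ : ∀ k (f : Vector ℕ n) j → cap k f j ≤ f j
cap-≤ k f fzero    = ℕP.m⊓n≤n k (f fzero)
cap-≤ k f (fsuc j) = cap-≤ (k ∸ f fzero) (tail f) j

⊓-+-∸ : ∀ k a b → k ⊓ a + (k ∸ a) ⊓ b ≡ k ⊓ (a + b)
⊓-+-∸ k a b with ℕP.≤-total k a
... | inj₁ k≤a = begin
  k ⊓ a + (k ∸ a) ⊓ b     ≡⟨ cong₂ (λ s t → s + t ⊓ b) (ℕP.m≤n⇒m⊓n≡m k≤a) (ℕP.m≤n⇒m∸n≡0 k≤a) ⟩
  k + 0                   ≡⟨ ℕP.+-identityʳ k ⟩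
  k                       ≡⟨ ℕP.m≤n⇒m⊓n≡m (ℕP.≤-trans k≤a (ℕP.m≤m+n a b)) ⟨
  k ⊓ (a + b)             ∎
  where open ≡-Reasoning
... | inj₂ a≤k = begin
  k ⊓ a + (k ∸ a) ⊓ b     ≡⟨ cong (_+ (k ∸ a) ⊓ b) (ℕP.m≥n⇒m⊓n≡n a≤k) ⟩
  a + (k ∸ a) ⊓ b         ≡⟨ ℕP.+-distribˡ-⊓ a (k ∸ a) b ⟩
  (a + (k ∸ a)) ⊓ (a + b) ≡⟨ cong (_⊓ (a + b)) (ℕP.m+[n∸m]≡n a≤k) ⟩
  k ⊓ (a + b)             ∎
  where open ≡-Reasoning

∑-cap : ∀ k (f : Vector ℕ n) → ℕΣ.sum (cap k f) ≡ k ⊓ ℕΣ.sum f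
∑-cap {zero}  k f = sym (ℕP.⊓-zeroʳ k)
∑-cap {suc n} k f = trans (cong (k ⊓ f fzero +_) (∑-cap (k ∸ f fzero) (tail f))) (⊓-+-∸ k (f fzero) _)

-- The diagonal i = j, absent from a sheet, is filled with a.
row : A → Sheet A n → Fin n → Vector A n
row a x i j with i ≟ j
... | yes _   = a
... | no i≢j = x i j i≢j

row-≢ : ∀ (a : A) x {i j : Fin n} (i≢j : i ≢ j) → row a x i j ≡ x i j i≢j
row-≢ a x {i} {j} i≢j with i ≟ j
... | yes i≡j = contradiction i≡j i≢j
... | no _    = refl

row-diag : ∀ (a : A) (x : Sheet A n) i → row a x i i ≡ a
row-diag a x i with i ≟ i
... | yes _   = refl
... | no i≢i = contradiction refl i≢i

row-cong : ∀ (a : A) {x y : Sheet A n} → x ≐ y → ∀ i j → row a x i j ≡ row a y i j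
row-cong a x≐y i j with i ≟ j
... | yes _   = refl
... | no i≢j = x≐y i j i≢j

row-map : ∀ (f : A → B) {a b} → f a ≡ b → (x : Sheet A n) →
          ∀ i j → row b (λ i j i≢j → f (x i j i≢j)) i j ≡ f (row a x i j)
row-map f fa≡b x i j with i ≟ j
... | yes _ = sym fa≡b
... | no _  = refl

row-map₂ : ∀ (f : A → B → C) {a b c} → f a b ≡ c → (x : Sheet A n) (y : Sheet B n) →
           ∀ i j → row c (λ i j i≢j → f (x i j i≢j) (y i j i≢j)) i j ≡ f (row a x i j) (row b y i j)
row-map₂ f fab≡c x y i j with i ≟ j
... | yes _ = sym fab≡c
... | no _  = refl

score≡∑row : (x : Sheet ℕ n) (i : Fin n) → score x i ≡ ℕΣ.sum (row 0 x i)
score≡∑row {n} x i = trans (sum-map-tabulate summand (λ j → j)) (ℕΣ.sum-cong-≗ summand≗row)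
  where
  -- `score` sums a local function of Defs, reachable only through its unfolding.
  summand : Fin n → ℕ
  summand = proj₁ {B = λ f → score x i ≡ sum (map f (allFin n))} (_ , refl)
  summand≗row : ∀ j → summand j ≡ row 0 x i j
  summand≗row j with i ≟ j
  ... | yes _ = refl
  ... | no _  = refl

score-cong : {x y : Sheet ℕ n} → x ≐ y → ∀ i → score x i ≡ score y i
score-cong {x = x} {y} x≐y i = begin
  score x i            ≡⟨ score≡∑row x i ⟩
  ℕΣ.sum (row 0 x i)   ≡⟨ ℕΣ.sum-cong-≗ (row-cong 0 x≐y i) ⟩
  ℕΣ.sum (row 0 y i)   ≡⟨ score≡∑row y i ⟨
  score y i            ∎
  where open ≡-Reasoning

score-⊕ : (x y : Sheet ℕ n) → ∀ i → score (x ⊕ y) i ≡ score x i + score y i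
score-⊕ x y i = begin
  score (x ⊕ y) i                            ≡⟨ score≡∑row (x ⊕ y) i ⟩
  ℕΣ.sum (row 0 (x ⊕ y) i)                   ≡⟨ ℕΣ.sum-cong-≗ (row-map₂ _+_ refl x y i) ⟩
  ℕΣ.sum (λ j → row 0 x i j + row 0 y i j)   ≡⟨ ℕΣ.∑-distrib-+ (row 0 x i) (row 0 y i) ⟩
  ℕΣ.sum (row 0 x i) + ℕΣ.sum (row 0 y i)    ≡⟨ cong₂ _+_ (score≡∑row x i) (score≡∑row y i) ⟨
  score x i + score y i                      ∎
  where open ≡-Reasoning

entry≤score : (x : Sheet ℕ n) → ∀ i j (i≢j : i ≢ j) → x i j i≢j ≤ score x i
entry≤score x i j i≢j = subst₂ _≤_ (row-≢ 0 x i≢j) (sym (score≡∑row x i)) (≤-∑ (row 0 x i) j)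

score≡0⇒entry≡0 : (x : Sheet ℕ n) → ∀ i → score x i ≡ 0 → ∀ j (i≢j : i ≢ j) → x i j i≢j ≡ 0
score≡0⇒entry≡0 x i s≡0 j i≢j =
  trans (sym (row-≢ 0 x i≢j)) (∑≡0⇒≡0 (row 0 x i) j (trans (sym (score≡∑row x i)) s≡0))

isZero⇒score≡0 : {x : Sheet ℕ n} → IsZero x → ∀ i → score x i ≡ 0
isZero⇒score≡0 {n} {x} x≡0 i = begin
  score x i                          ≡⟨ score-cong {y = zeroSheet} x≡0 i ⟩
  score zeroSheet i                  ≡⟨ score≡∑row zeroSheet i ⟩
  ℕΣ.sum (row 0 zeroSheet i)         ≡⟨ ℕΣ.sum-cong-≗ (row-map (λ _ → 0) {a = 0} refl x i) ⟩
  ℕΣ.sum {n} (λ _ → 0)               ≡⟨ ℕΣ.sum-replicate-zero n ⟩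
  0                                  ∎
  where
  open ≡-Reasoning
  zeroSheet : Sheet ℕ n
  zeroSheet _ _ _ = 0

∣-score : ∀ {d} (x : Sheet ℕ n) i → (∀ j (i≢j : i ≢ j) → d ∣ x i j i≢j) → d ∣ score x i
∣-score {d = d} x i d∣x = subst (d ∣_) (sym (score≡∑row x i)) (∣-∑ (row 0 x i) d∣row)
  where
  d∣row : ∀ j → d ∣ row 0 x i j
  d∣row j with i ≟ j
  ... | yes _   = d ∣0
  ... | no i≢j = d∣x j i≢j

ordered⇒topScore≡0⇒isZero : {x : Sheet ℕ (suc n)} → Ordered x → score x fzero ≡ 0 → IsZero x
ordered⇒topScore≡0⇒isZero {x = x} ordered s≡0 i =
  score≡0⇒entry≡0 x i (ℕP.n≤0⇒n≡0 (subst (score x i ≤_) s≡0 (ordered fzero i z≤n)))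

nonZero⇒topScore>0 : {x : Sheet ℕ (suc n)} → Ordered x → ¬ IsZero x → 0 < score x fzero
nonZero⇒topScore>0 ordered x≢0 = ℕP.n≢0⇒n>0 (x≢0 ∘ ordered⇒topScore≡0⇒isZero ordered)

ordered-if-score-monotone : ∀ {x y : Sheet ℕ n} (φ : ℕ → ℕ) → (∀ {a b} → a ≤ b → φ a ≤ φ b) →
  (∀ i → score y i ≡ φ (score x i)) → Ordered x → Ordered y
ordered-if-score-monotone φ φ-mono y≡φx x-ordered i j i≤j =
  subst₂ _≤_ (sym (y≡φx j)) (sym (y≡φx i)) (φ-mono (x-ordered i j i≤j))

capRows : ℕ → Sheet ℕ n → Sheet ℕ n
capRows k x i j _ = cap k (row 0 x i) j

excessRows : ℕ → Sheet ℕ n → Sheet ℕ n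
excessRows k x i j i≢j = x i j i≢j ∸ capRows k x i j i≢j

capRows-⊕-excessRows : ∀ k (x : Sheet ℕ n) → x ≐ (capRows k x ⊕ excessRows k x)
capRows-⊕-excessRows k x i j i≢j =
  sym (ℕP.m+[n∸m]≡n (subst (cap k (row 0 x i) j ≤_) (row-≢ 0 x i≢j) (cap-≤ k (row 0 x i) j)))

score-capRows : ∀ k (x : Sheet ℕ n) i → score (capRows k x) i ≡ k ⊓ score x i
score-capRows k x i = begin
  score (capRows k x) i            ≡⟨ score≡∑row (capRows k x) i ⟩
  ℕΣ.sum (row 0 (capRows k x) i)   ≡⟨ ℕΣ.sum-cong-≗ row≗cap ⟩
  ℕΣ.sum (cap k (row 0 x i))       ≡⟨ ∑-cap k (row 0 x i) ⟩
  k ⊓ ℕΣ.sum (row 0 x i)           ≡⟨ cong (k ⊓_) (score≡∑row x i) ⟨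
  k ⊓ score x i                    ∎
  where
  open ≡-Reasoning
  row≗cap : ∀ j → row 0 (capRows k x) i j ≡ cap k (row 0 x i) j
  row≗cap j with i ≟ j
  ... | yes refl = sym (ℕP.n≤0⇒n≡0 (subst (cap k (row 0 x i) i ≤_) (row-diag 0 x i) (cap-≤ k (row 0 x i) i)))
  ... | no _     = refl

score-excessRows : ∀ k (x : Sheet ℕ n) i → score (excessRows k x) i ≡ score x i ∸ k
score-excessRows k x i = ℕP.+-cancelˡ-≡ (k ⊓ score x i) _ _ (begin
  k ⊓ score x i + score (excessRows k x) i              ≡⟨ cong (_+ score (excessRows k x) i) (score-capRows k x i) ⟨
  score (capRows k x) i + score (excessRows k x) i      ≡⟨ score-⊕ (capRows k x) (excessRows k x) i ⟨
  score (capRows k x ⊕ excessRows k x) i                ≡⟨ score-cong (capRows-⊕-excessRows k x) i ⟨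
  score x i                                             ≡⟨ ℕP.m⊓n+n∸m≡n k (score x i) ⟨
  k ⊓ score x i + (score x i ∸ k)                       ∎)
  where open ≡-Reasoning

ordered-capRows : ∀ k {x : Sheet ℕ n} → Ordered x → Ordered (capRows k x)
ordered-capRows k = ordered-if-score-monotone (k ⊓_) (ℕP.⊓-monoʳ-≤ k) (score-capRows k _)

ordered-excessRows : ∀ k {x : Sheet ℕ n} → Ordered x → Ordered (excessRows k x)
ordered-excessRows k = ordered-if-score-monotone (_∸ k) (ℕP.∸-monoˡ-≤ k) (score-excessRows k _)

topScore≡1⇒inHilbertBasis : {x : Sheet ℕ (suc n)} → Ordered x → score x fzero ≡ 1 → InHilbertBasis x
topScore≡1⇒inHilbertBasis {x = x} ordered s≡1 = ordered , x≢0 , irreducible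
  where
  x≢0 : ¬ IsZero x
  x≢0 x≡0 = ℕP.0≢1+n (trans (sym (isZero⇒score≡0 x≡0 fzero)) s≡1)
  irreducible : ¬ (Σ _ λ y → Σ _ λ z → InM y × InM z × ¬ IsZero y × ¬ IsZero z × x ≐ (y ⊕ z))
  irreducible (y , z , y∈M , z∈M , y≢0 , z≢0 , x≐y⊕z) =
    ℕP.<⇒≢ (ℕP.+-mono-≤ (nonZero⇒topScore>0 y∈M y≢0) (nonZero⇒topScore>0 z∈M z≢0))
            (trans (sym s≡1) (trans (score-cong x≐y⊕z fzero) (score-⊕ y z fzero)))

inHilbertBasis⇒topScore≡1 : {x : Sheet ℕ (suc n)} → InHilbertBasis x → score x fzero ≡ 1
inHilbertBasis⇒topScore≡1 {x = x} (ordered , x≢0 , irreducible) =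
  ℕP.≤-antisym (ℕP.m∸n≡0⇒m≤n (trans (sym (score-excessRows 1 x fzero)) excess≡0)) s>0
  where
  s>0 : 0 < score x fzero
  s>0 = nonZero⇒topScore>0 ordered x≢0
  unit≢0 : ¬ IsZero (capRows 1 x)
  unit≢0 u≡0 = ℕP.0≢1+n (trans (sym (isZero⇒score≡0 u≡0 fzero))
                                (trans (score-capRows 1 x fzero) (ℕP.m≤n⇒m⊓n≡m s>0)))
  excess≡0 : score (excessRows 1 x) fzero ≡ 0
  excess≡0 = decidable-stable (_ ℕ.≟ 0) λ excess≢0 →
    irreducible (capRows 1 x , excessRows 1 x , ordered-capRows 1 ordered , ordered-excessRows 1 ordered ,
                 unit≢0 , excess≢0 ∘ (λ r≡0 → isZero⇒score≡0 r≡0 fzero) , capRows-⊕-excessRows 1 x)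

scoreℚ : Sheet ℚ n → Fin n → ℚ
scoreℚ y i = ℚΣ.sum (row 0ℚ y i)

scoreℚ-ℕtoℚ : (x : Sheet ℕ n) → ∀ i → scoreℚ (toℚ (toℤ x)) i ≡ ℕtoℚ (score x i)
scoreℚ-ℕtoℚ x i = begin
  ℚΣ.sum (row 0ℚ (toℚ (toℤ x)) i)  ≡⟨ ℚΣ.sum-cong-≗ (row-map ℕtoℚ refl x i) ⟩
  ℚΣ.sum (ℕtoℚ ∘ row 0 x i)        ≡⟨ ℕtoℚ-∑ (row 0 x i) ⟨
  ℕtoℚ (ℕΣ.sum (row 0 x i))        ≡⟨ cong ℕtoℚ (score≡∑row x i) ⟨
  ℕtoℚ (score x i)                 ∎
  where open ≡-Reasoning

record IsLinear (L : Sheet ℚ n → ℚ) : Set where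
  field
    ≐-cong : ∀ {x y} → x ≐ y → L x ≡ L y
    0-homo : L (λ _ _ _ → 0ℚ) ≡ 0ℚ
    +-homo : ∀ x y → L (x ⊕ℚ y) ≡ L x ℚ.+ L y
    ·-homo : ∀ c x → L (c ·ℚ x) ≡ c ℚ.* L x

zero-isLinear : IsLinear {n} (λ _ → 0ℚ)
zero-isLinear = record
  { ≐-cong = λ _ → refl
  ; 0-homo = refl
  ; +-homo = λ _ _ → sym (ℚP.+-identityʳ 0ℚ)
  ; ·-homo = λ c _ → sym (ℚP.*-zeroʳ c)
  }

entry-isLinear : ∀ (i j : Fin n) i≢j → IsLinear (λ y → y i j i≢j)
entry-isLinear i j i≢j = record
  { ≐-cong = λ x≐y → x≐y i j i≢j
  ; 0-homo = refl
  ; +-homo = λ _ _ → refl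
  ; ·-homo = λ _ _ → refl
  }

scoreℚ-isLinear : ∀ (i : Fin n) → IsLinear (λ y → scoreℚ y i)
scoreℚ-isLinear {n} i = record
  { ≐-cong = λ x≐y → ℚΣ.sum-cong-≗ (row-cong 0ℚ x≐y i)
  ; 0-homo = trans (ℚΣ.sum-cong-≗ (row-map (λ _ → 0ℚ) {a = 0ℚ} refl (λ _ _ _ → 0ℚ) i))
                   (ℚΣ.sum-replicate-zero n)
  ; +-homo = λ x y → trans (ℚΣ.sum-cong-≗ (row-map₂ ℚ._+_ (ℚP.+-identityʳ 0ℚ) x y i))
                           (ℚΣ.∑-distrib-+ (row 0ℚ x i) (row 0ℚ y i))
  ; ·-homo = λ c x → trans (ℚΣ.sum-cong-≗ (row-map (c ℚ.*_) (ℚP.*-zeroʳ c) x i))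
                           (sym (ℚΣ.*-distribˡ-sum c (row 0ℚ x i)))
  }

Generator : ℕ → Set
Generator n = ℚ × Σ (Sheet ℕ n) InM

combination : List (Generator n) → Sheet ℚ n
combination []                  i j i≢j = 0ℚ
combination ((c , m , _) ∷ gs) i j i≢j = c ℚ.* ℕtoℚ (m i j i≢j) ℚ.+ combination gs i j i≢j

NonNegCoefficients : List (Generator n) → Set
NonNegCoefficients = All (λ g → 0ℚ ℚ.≤ proj₁ g)

-- `InCone` folds with anonymous functions of Defs; only their defining
-- equations are available, so the two folds are abstracted over them.
foldr-combination : ∀ (i j : Fin n) i≢j (step : Generator n → ℚ → ℚ) →
  (∀ c m m∈M acc → step (c , m , m∈M) acc ≡ c ℚ.* ℕtoℚ (m i j i≢j) ℚ.+ acc) →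
  ∀ gs → foldr step 0ℚ gs ≡ combination gs i j i≢j
foldr-combination i j i≢j step step≡ []                  = refl
foldr-combination i j i≢j step step≡ ((c , m , m∈M) ∷ gs) =
  trans (step≡ c m m∈M _) (cong (c ℚ.* ℕtoℚ (m i j i≢j) ℚ.+_) (foldr-combination i j i≢j step step≡ gs))

foldr-nonNeg : (step : Generator n → Set → Set) → (∀ g acc → step g acc → 0ℚ ℚ.≤ proj₁ g × acc) →
  ∀ gs → foldr step ⊤ gs → NonNegCoefficients gs
foldr-nonNeg step step⇒ []       tt = []
foldr-nonNeg step step⇒ (g ∷ gs) h with step⇒ g _ h
... | 0≤c , rest = 0≤c ∷ foldr-nonNeg step step⇒ gs rest

inCone⇒combination : {y : Sheet ℚ n} → InCone y →
  Σ (List (Generator n)) λ gs → NonNegCoefficients gs × y ≐ combination gs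
inCone⇒combination (gs , nonNeg , y≡) =
  gs , foldr-nonNeg _ (λ _ _ h → h) gs nonNeg ,
  λ i j i≢j → trans (y≡ i j i≢j) (foldr-combination i j i≢j _ (λ _ _ _ _ → refl) gs)

inCone-generator : (m : Sheet ℕ n) → InM m → InCone (toℚ (toℤ m))
inCone-generator m m∈M =
  (1ℚ , m , m∈M) ∷ [] , (0≤ℕtoℚ 1 , tt) ,
  λ i j i≢j → sym (trans (ℚP.+-identityʳ _) (ℚP.*-identityˡ _))

module _ {L L′ : Sheet ℚ n → ℚ} (L-linear : IsLinear L) (L′-linear : IsLinear L′)
         (L≤L′ : ∀ m → InM m → L (toℚ (toℤ m)) ℚ.≤ L′ (toℚ (toℤ m))) where
  private
    module L = IsLinear L-linear
    module L′ = IsLinear L′-linear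

  combination-≤ : ∀ gs → NonNegCoefficients gs → L (combination gs) ℚ.≤ L′ (combination gs)
  combination-≤ []                  []             = ℚP.≤-reflexive (trans L.0-homo (sym L′.0-homo))
  combination-≤ ((c , m , m∈M) ∷ gs) (0≤c ∷ nonNeg) = begin
    L (combination ((c , m , m∈M) ∷ gs))              ≡⟨ L.+-homo (c ·ℚ toℚ (toℤ m)) (combination gs) ⟩
    L (c ·ℚ toℚ (toℤ m)) ℚ.+ L (combination gs)       ≡⟨ cong (ℚ._+ _) (L.·-homo c _) ⟩
    c ℚ.* L (toℚ (toℤ m)) ℚ.+ L (combination gs)      ≤⟨ ℚP.+-mono-≤ (ℚP.*-monoˡ-≤-nonNeg c {{ℚ.nonNegative 0≤c}} (L≤L′ m m∈M))
                                                                     (combination-≤ gs nonNeg) ⟩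
    c ℚ.* L′ (toℚ (toℤ m)) ℚ.+ L′ (combination gs)    ≡⟨ cong (ℚ._+ _) (L′.·-homo c _) ⟨
    L′ (c ·ℚ toℚ (toℤ m)) ℚ.+ L′ (combination gs)     ≡⟨ L′.+-homo (c ·ℚ toℚ (toℤ m)) (combination gs) ⟨
    L′ (combination ((c , m , m∈M) ∷ gs))             ∎
    where open ℚP.≤-Reasoning

  inCone⇒≤ : {y : Sheet ℚ n} → InCone y → L y ℚ.≤ L′ y
  inCone⇒≤ y∈C with inCone⇒combination y∈C
  ... | gs , nonNeg , y≐ = subst₂ ℚ._≤_ (sym (L.≐-cong y≐)) (sym (L′.≐-cong y≐)) (combination-≤ gs nonNeg)

module _ {y : Sheet ℚ n} (y∈C : InCone y) where
  inCone⇒entry≥0 : ∀ i j i≢j → 0ℚ ℚ.≤ y i j i≢j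
  inCone⇒entry≥0 i j i≢j = inCone⇒≤ zero-isLinear (entry-isLinear i j i≢j) (λ m _ → 0≤ℕtoℚ (m i j i≢j)) y∈C

  inCone⇒scoreℚ≥0 : ∀ i → 0ℚ ℚ.≤ scoreℚ y i
  inCone⇒scoreℚ≥0 i = inCone⇒≤ zero-isLinear (scoreℚ-isLinear i)
    (λ m _ → subst (0ℚ ℚ.≤_) (sym (scoreℚ-ℕtoℚ m i)) (0≤ℕtoℚ (score m i))) y∈C

  inCone⇒entry≤scoreℚ : ∀ i j i≢j → y i j i≢j ℚ.≤ scoreℚ y i
  inCone⇒entry≤scoreℚ i j i≢j = inCone⇒≤ (entry-isLinear i j i≢j) (scoreℚ-isLinear i)
    (λ m _ → subst (ℕtoℚ (m i j i≢j) ℚ.≤_) (sym (scoreℚ-ℕtoℚ m i)) (ℕtoℚ-mono-≤ (entry≤score m i j i≢j))) y∈C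

  inCone⇒scoreℚ-antitone : ∀ i j → i Fin.≤ j → scoreℚ y j ℚ.≤ scoreℚ y i
  inCone⇒scoreℚ-antitone i j i≤j = inCone⇒≤ (scoreℚ-isLinear j) (scoreℚ-isLinear i)
    (λ m m∈M → subst₂ ℚ._≤_ (sym (scoreℚ-ℕtoℚ m j)) (sym (scoreℚ-ℕtoℚ m i)) (ℕtoℚ-mono-≤ (m∈M i j i≤j))) y∈C

topScore≡1⇒extremeIntegralGenerator : {x : Sheet ℕ (suc n)} → Ordered x → score x fzero ≡ 1 →
  ExtremeIntegralGenerator (toℤ x)
topScore≡1⇒extremeIntegralGenerator {x = x} ordered s≡1 =
  coprime , inCone-generator x ordered , x≢0 , extremal
  where
  coprime : Coprime (toℤ x)
  coprime d d∣x = ∣1⇒≡1 (subst (d ∣_) s≡1 (∣-score x fzero (d∣x fzero)))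
  x≢0 : ¬ (∀ i j i≢j → ℕtoℚ (x i j i≢j) ≡ 0ℚ)
  x≢0 x≡0 = ℕP.0≢1+n (trans (sym (isZero⇒score≡0 (λ i j i≢j → ℕtoℚ-injective {b = 0} (x≡0 i j i≢j)) fzero)) s≡1)
  entry≤1 : ∀ i j i≢j → x i j i≢j ≤ 1
  entry≤1 i j i≢j = ℕP.≤-trans (entry≤score x i j i≢j) (subst (score x i ≤_) s≡1 (ordered fzero i z≤n))
  extremal : ∀ y z → InCone y → InCone z → toℚ (toℤ x) ≐ (y ⊕ℚ z) →
    Σ ℚ λ c → 0ℚ ℚ.≤ c × y ≐ (c ·ℚ toℚ (toℤ x))
  extremal y z y∈C z∈C x≐y+z = c , inCone⇒scoreℚ≥0 y∈C fzero , y≐cx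
    where
    c : ℚ
    c = scoreℚ y fzero
    entry≤topScoreℚ : ∀ {w} → InCone w → ∀ i j i≢j → w i j i≢j ℚ.≤ scoreℚ w fzero
    entry≤topScoreℚ w∈C i j i≢j =
      ℚP.≤-trans (inCone⇒entry≤scoreℚ w∈C i j i≢j) (inCone⇒scoreℚ-antitone w∈C fzero i z≤n)
    y+z≡topScores : ∀ i j i≢j → x i j i≢j ≡ 1 → y i j i≢j ℚ.+ z i j i≢j ≡ c ℚ.+ scoreℚ z fzero
    y+z≡topScores i j i≢j x≡1 = begin
      y i j i≢j ℚ.+ z i j i≢j      ≡⟨ x≐y+z i j i≢j ⟨
      ℕtoℚ (x i j i≢j)             ≡⟨ cong ℕtoℚ (trans x≡1 (sym s≡1)) ⟩
      ℕtoℚ (score x fzero)         ≡⟨ scoreℚ-ℕtoℚ x fzero ⟨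
      scoreℚ (toℚ (toℤ x)) fzero   ≡⟨ IsLinear.≐-cong (scoreℚ-isLinear fzero) x≐y+z ⟩
      scoreℚ (y ⊕ℚ z) fzero        ≡⟨ IsLinear.+-homo (scoreℚ-isLinear fzero) y z ⟩
      c ℚ.+ scoreℚ z fzero         ∎
      where open ≡-Reasoning
    y≐cx : y ≐ (c ·ℚ toℚ (toℤ x))
    y≐cx i j i≢j with ℕP.n≤1⇒n≡0∨n≡1 (entry≤1 i j i≢j)
    ... | inj₁ x≡0 = trans
      (sym (+-≡-squeezeˡ (inCone⇒entry≥0 y∈C i j i≢j) (inCone⇒entry≥0 z∈C i j i≢j)
                         (trans (ℚP.+-identityʳ 0ℚ) (trans (cong ℕtoℚ (sym x≡0)) (x≐y+z i j i≢j)))))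
      (sym (trans (cong (λ k → c ℚ.* ℕtoℚ k) x≡0) (ℚP.*-zeroʳ c)))
    ... | inj₂ x≡1 = trans
      (+-≡-squeezeˡ (entry≤topScoreℚ y∈C i j i≢j) (entry≤topScoreℚ z∈C i j i≢j) (y+z≡topScores i j i≢j x≡1))
      (sym (trans (cong (λ k → c ℚ.* ℕtoℚ k) x≡1) (ℚP.*-identityʳ c)))

extremeIntegralGenerator⇒inHilbertBasis : (v : Sheet ℤ (suc n)) → ExtremeIntegralGenerator v →
  Σ (Sheet ℕ (suc n)) λ x → InHilbertBasis x × v ≐ toℤ x
extremeIntegralGenerator⇒inHilbertBasis {n} v (coprime , v∈C , v≢0 , extremal) =
  x , topScore≡1⇒inHilbertBasis ordered s≡1 , v≐x
  where
  x : Sheet ℕ (suc n)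
  x i j i≢j = ℤ.∣ v i j i≢j ∣
  v≐x : v ≐ toℤ x
  v≐x i j i≢j = 0≤ℤtoℚ⇒≡+∣∣ (v i j i≢j) (inCone⇒entry≥0 v∈C i j i≢j)
  scoreℚ-v : ∀ i → scoreℚ (toℚ v) i ≡ ℕtoℚ (score x i)
  scoreℚ-v i = trans (IsLinear.≐-cong (scoreℚ-isLinear i) (λ i j i≢j → cong ℤtoℚ (v≐x i j i≢j))) (scoreℚ-ℕtoℚ x i)
  ordered : Ordered x
  ordered i j i≤j = ℕtoℚ-cancel-≤ (subst₂ ℚ._≤_ (scoreℚ-v j) (scoreℚ-v i) (inCone⇒scoreℚ-antitone v∈C i j i≤j))
  s : ℕ
  s = score x fzero
  s>0 : 0 < s
  s>0 = nonZero⇒topScore>0 ordered λ x≡0 → v≢0 λ i j i≢j → cong ℤtoℚ (trans (v≐x i j i≢j) (cong ℤ.+_ (x≡0 i j i≢j)))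
  u r : Sheet ℕ (suc n)
  u = capRows 1 x
  r = excessRows 1 x
  v≐u+r : toℚ v ≐ (toℚ (toℤ u) ⊕ℚ toℚ (toℤ r))
  v≐u+r i j i≢j = trans (cong ℤtoℚ (v≐x i j i≢j))
    (trans (cong ℕtoℚ (capRows-⊕-excessRows 1 x i j i≢j)) (ℕtoℚ-+ (u i j i≢j) (r i j i≢j)))
  u-on-ray : Σ ℚ λ c → 0ℚ ℚ.≤ c × toℚ (toℤ u) ≐ (c ·ℚ toℚ v)
  u-on-ray = extremal (toℚ (toℤ u)) (toℚ (toℤ r)) (inCone-generator u (ordered-capRows 1 ordered))
                      (inCone-generator r (ordered-excessRows 1 ordered)) v≐u+r
  c : ℚ
  c = proj₁ u-on-ray
  u≐cv : toℚ (toℤ u) ≐ (c ·ℚ toℚ v)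
  u≐cv = proj₂ (proj₂ u-on-ray)
  c*s≡1 : c ℚ.* ℕtoℚ s ≡ 1ℚ
  c*s≡1 = begin
    c ℚ.* ℕtoℚ s                  ≡⟨ cong (c ℚ.*_) (scoreℚ-v fzero) ⟨
    c ℚ.* scoreℚ (toℚ v) fzero    ≡⟨ IsLinear.·-homo (scoreℚ-isLinear fzero) c (toℚ v) ⟨
    scoreℚ (c ·ℚ toℚ v) fzero     ≡⟨ IsLinear.≐-cong (scoreℚ-isLinear fzero) u≐cv ⟨
    scoreℚ (toℚ (toℤ u)) fzero    ≡⟨ scoreℚ-ℕtoℚ u fzero ⟩
    ℕtoℚ (score u fzero)          ≡⟨ cong ℕtoℚ (trans (score-capRows 1 x fzero) (ℕP.m≤n⇒m⊓n≡m s>0)) ⟩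
    1ℚ                            ∎
    where open ≡-Reasoning
  s∣x : ∀ i j i≢j → s ∣ x i j i≢j
  s∣x i j i≢j = subst (s ∣_) (c*s≡1∧u≡c*x⇒s*u≡x {c} s (u i j i≢j) (x i j i≢j) c*s≡1
                                (trans (u≐cv i j i≢j) (cong (λ q → c ℚ.* ℤtoℚ q) (v≐x i j i≢j))))
                      (m∣m*n (u i j i≢j))
  s≡1 : s ≡ 1
  s≡1 = coprime s s∣x

corollary4p4 : (n : ℕ) → 1 ≤ n →
    ((x : Sheet ℕ n) → InHilbertBasis x → ExtremeIntegralGenerator (toℤ x))
    × ((v : Sheet ℤ n) → ExtremeIntegralGenerator v →
        Σ (Sheet ℕ n) λ x → InHilbertBasis x × v ≐ toℤ x)
corollary4p4 zero    ()
corollary4p4 (suc n) _ =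
  (λ x x∈HB → topScore≡1⇒extremeIntegralGenerator (proj₁ x∈HB) (inHilbertBasis⇒topScore≡1 x∈HB)) ,
  extremeIntegralGenerator⇒inHilbertBasis
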